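{- Let $F_{26}$ denote the (unique) fullerene graph with $26$ vertices. Then $af(F_{26})=5$.
   Context: A fullerene graph is a cubic (3-regular), 3-connected plane graph all of whose faces are pentagons or hexagons; up to isomorphism there is exactly one fullerene graph on 26 vertices. For a graph $G$ with a perfect matching, a set $S\subseteq E(G)$ is an anti-forcing set if $G-S$ has a unique perfect matching; the anti-forcing number $af(G)$ is the minimum cardinality of an anti-forcing set of $G$. -}

module Defs where

open import Data.Nat using (ℕ; _≤_)
open import Data.Fin using (Fin; _≟_; #_)
open import Data.Fin.Subset using (Subset; _∩_; ∁; _⊆_; ∣_∣)
open import Data.Vec using (Vec; []; _∷_; lookup; tabulate)
open import Data.Bool using (_∨_)
open import Data.Product using (Σ; _×_; _,_; proj₁; proj₂; ∃-syntax)
open import Relation.Nullary.Decidable using (isYes)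
open import Relation.Binary.PropositionalEquality using (_≡_)

record Graph : Set where
  field
    nV    : ℕ
    nE    : ℕ
    ends  : Fin nE → Fin nV × Fin nV

open Graph public

EdgeSet : Graph → Set
EdgeSet G = Subset (nE G)

incident : (G : Graph) → Fin (nV G) → EdgeSet G
incident G v = tabulate λ e →
  isYes (v ≟ proj₁ (ends G e)) ∨ isYes (v ≟ proj₂ (ends G e))

IsPerfectMatching : (G : Graph) → EdgeSet G → Set
IsPerfectMatching G M = ∀ v → ∣ M ∩ incident G v ∣ ≡ 1

-- M is a perfect matching of G - S (same vertex set, edges of S removed).
IsPMofMinus : (G : Graph) → EdgeSet G → EdgeSet G → Set
IsPMofMinus G S M = M ⊆ ∁ S × IsPerfectMatching G M

IsAntiForcingSet : (G : Graph) → EdgeSet G → Set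
IsAntiForcingSet G S =
  Σ (EdgeSet G) λ M → IsPMofMinus G S M × (∀ M' → IsPMofMinus G S M' → M' ≡ M)

AntiForcingNumber : Graph → ℕ → Set
AntiForcingNumber G k =
  (∃[ S ] (IsAntiForcingSet G S × ∣ S ∣ ≡ k))
  × (∀ S → IsAntiForcingSet G S → k ≤ ∣ S ∣)

-- Its 15 faces (12 pentagons, 3 hexagons) are, as cyclic vertex sequences:
--   [0,1,5,4,3,2] [0,1,7,8,6] [0,2,9,10,6] [2,3,11,12,9] [3,4,13,14,11]
--   [4,5,15,16,13] [1,5,15,17,7] [7,8,18,20,19,17] [6,8,18,21,10]
--   [9,10,21,22,12] [11,12,22,24,23,14] [13,14,23,25,16] [15,16,25,19,17]
--   [19,20,24,23,25] [18,20,24,22,21]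
F26edges : Vec (Fin 26 × Fin 26) 39
F26edges =
  (# 0 , # 1) ∷ (# 0 , # 2) ∷ (# 0 , # 6) ∷ (# 1 , # 5) ∷ (# 1 , # 7) ∷ (# 2 , # 3) ∷ (# 2 , # 9) ∷
  (# 3 , # 4) ∷ (# 3 , # 11) ∷ (# 4 , # 5) ∷ (# 4 , # 13) ∷ (# 5 , # 15) ∷ (# 6 , # 8) ∷ (# 6 , # 10) ∷
  (# 7 , # 8) ∷ (# 7 , # 17) ∷ (# 8 , # 18) ∷ (# 9 , # 10) ∷ (# 9 , # 12) ∷ (# 10 , # 21) ∷
  (# 11 , # 12) ∷ (# 11 , # 14) ∷ (# 12 , # 22) ∷ (# 13 , # 14) ∷ (# 13 , # 16) ∷ (# 14 , # 23) ∷
  (# 15 , # 16) ∷ (# 15 , # 17) ∷ (# 16 , # 25) ∷ (# 17 , # 19) ∷ (# 18 , # 20) ∷ (# 18 , # 21) ∷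
  (# 19 , # 20) ∷ (# 19 , # 25) ∷ (# 20 , # 24) ∷ (# 21 , # 22) ∷ (# 22 , # 24) ∷ (# 23 , # 24) ∷
  (# 23 , # 25) ∷ []

F26 : Graph
F26 = record { nV = 26 ; nE = 39 ; ends = lookup F26edges }

-- A set S of edges is anti-forcing exactly when one perfect matching is disjoint
-- from S, so everything reduces to the finite family of perfect matchings.
-- These are the solutions of the exact-one constraints at the vertices,
-- enumerated by branching on the edges and pruning as soon as some vertex is
-- over- or under-covered; F26 has 63 of them.  Five well-chosen edges avoid
-- exactly one.  For the lower bound a search decides edge by edge whether it
-- lies in S, carrying along only the matchings still disjoint from S, and
-- checks that no S of at most four edges leaves exactly one matching.

module Submission where

open import Defs
open import Data.Bool using (Bool; true; false; T; _∧_; if_then_else_)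
open import Data.Bool.Properties using (T-∧; T-≡)
import Data.Bool as Bool
open import Data.Fin using (#_)
open import Data.Fin.Subset using (Subset; inside; outside; _∩_; ∁; _⊆_; ∣_∣; ⁅_⁆; ⋃)
open import Data.Fin.Subset.Properties
  using (_⊆?_; drop-∷-⊆; out⊆; in⊆in; ∣p∩q∣≤∣q∣; x∈p⇒∣p-x∣<∣p∣; x∉p⇒x∈∁p)
open import Data.List using (List; []; _∷_; map; filter; _++_; allFin; length)
open import Data.List.Membership.Propositional using (_∈_; find)
open import Data.List.Membership.Propositional.Properties
  using (∈-map⁺; ∈-map⁻; ∈-++⁺ˡ; ∈-++⁺ʳ; ∈-++⁻; ∈-filter⁺; ∈-filter⁻; ∈-allFin)
open import Data.List.Relation.Unary.All as All using (All; all?)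
open import Data.List.Relation.Unary.All.Properties using (map⁺; map⁻; tabulate⁺)
open import Data.List.Relation.Unary.Any using (here; there; any?)
open import Data.Nat using (ℕ; zero; suc; _+_; _≤_; _<_; _≤?_; z≤n; s≤s)
open import Data.Nat.Properties
  using ( ≤-antisym; ≤-trans; <-≤-trans; ≤-reflexive; m≤m+n; +-monoʳ-≤; +-identityʳ; +-suc
        ; n≮0; ≤-<-connex)
open import Data.Product using (∃-syntax; _×_; _,_; proj₁; proj₂; map₂)
open import Data.Sum using (inj₁; inj₂)
open import Data.Vec using ([]; _∷_; head; tail)
import Data.Vec.Base as Vec
open import Data.Vec.Properties using (≡-dec)
open import Function using (id; _∘_; _⇔_; mk⇔; Equivalence)
open import Relation.Binary.Definitions using (DecidableEquality)
open import Relation.Binary.PropositionalEquality using (_≡_; _≢_; refl; sym; cong; subst)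
open import Relation.Nullary using (yes; no; does; ¬?; contradiction)
open import Relation.Nullary.Decidable using (isYes; toWitness; _×-dec_)
open import Relation.Unary using (Decidable)

private
  variable
    m n : ℕ

∷⊆outside∷⇒outside : ∀ {x} {p q : Subset n} → x ∷ p ⊆ outside ∷ q → x ≡ outside
∷⊆outside∷⇒outside {x = outside} _ = refl
∷⊆outside∷⇒outside {x = inside} x∷p⊆ with x∷p⊆ Vec.here
... | ()

∷⊆inside∷ : ∀ x {p q : Subset n} → p ⊆ q → x ∷ p ⊆ inside ∷ q
∷⊆inside∷ outside = out⊆
∷⊆inside∷ inside  = in⊆in

∣p∣≤0⇒q⊆∁p : {p q : Subset n} → ∣ p ∣ ≤ 0 → q ⊆ ∁ p
∣p∣≤0⇒q⊆∁p ∣p∣≤0 _ = x∉p⇒x∈∁p λ x∈p → n≮0 (<-≤-trans (x∈p⇒∣p-x∣<∣p∣ x∈p) ∣p∣≤0)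

-- A clause (k , c) of an exact-one constraint records that k elements have
-- already been chosen among the decided coordinates, and c is what remains.

Clause : ℕ → Set
Clause n = ℕ × Subset n

Satisfies : Subset n → Clause n → Set
Satisfies M (k , c) = k + ∣ M ∩ c ∣ ≡ 1

Viable : Clause n → Set
Viable (k , c) = k ≤ 1 × 1 ≤ k + ∣ c ∣

viable? : Decidable (Viable {n})
viable? (k , c) = k ≤? 1 ×-dec 1 ≤? k + ∣ c ∣

satisfies⇒viable : ∀ {M : Subset n} cl → Satisfies M cl → Viable cl
satisfies⇒viable {M = M} (k , c) k+∣M∩c∣≡1 =
  ≤-trans (m≤m+n k _) (≤-reflexive k+∣M∩c∣≡1) ,
  ≤-trans (≤-reflexive (sym k+∣M∩c∣≡1)) (+-monoʳ-≤ k (∣p∩q∣≤∣q∣ M c))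

viable⇒satisfies[] : ∀ cl → Viable cl → Satisfies [] cl
viable⇒satisfies[] (k , []) (k≤1 , 1≤k+0) =
  ≤-antisym (≤-trans (≤-reflexive (+-identityʳ k)) k≤1) 1≤k+0

consume : Bool → Clause (suc n) → Clause n
consume true (k , true ∷ c) = suc k , c
consume _    (k , _ ∷ c)    = k , c

satisfies-consume : ∀ b (M : Subset n) cl → Satisfies (b ∷ M) cl ≡ Satisfies M (consume b cl)
satisfies-consume true  M (k , true ∷ c)  = cong (_≡ 1) (+-suc k ∣ M ∩ c ∣)
satisfies-consume true  M (k , false ∷ c) = refl
satisfies-consume false M (k , _ ∷ c)     = refl

solutions : List (Clause n) → List (Subset n)
extensions : List (Clause n) → List (Subset n)
extend : Bool → List (Clause (suc n)) → List (Subset (suc n))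

solutions cs = if does (all? viable? cs) then extensions cs else []

extensions {zero}  _  = [] ∷ []
extensions {suc n} cs = extend outside cs ++ extend inside cs

extend b cs = map (b ∷_) (solutions (map (consume b) cs))

module _ (b : Bool) (M : Subset n) {cs : List (Clause (suc n))} where

  consume-all : All (Satisfies (b ∷ M)) cs → All (Satisfies M) (map (consume b) cs)
  consume-all = map⁺ ∘ All.map λ {cl} → subst id (satisfies-consume b M cl)

  unconsume-all : All (Satisfies M) (map (consume b) cs) → All (Satisfies (b ∷ M)) cs
  unconsume-all = All.map (λ {cl} → subst id (sym (satisfies-consume b M cl))) ∘ map⁻

all-viable : ∀ (M : Subset n) {cs} → All (Satisfies M) cs → All Viable cs
all-viable M = All.map λ {cl} → satisfies⇒viable {M = M} cl

solutions-complete : ∀ (cs : List (Clause n)) {M} → All (Satisfies M) cs → M ∈ solutions cs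
extensions-complete : ∀ (cs : List (Clause n)) {M} → All (Satisfies M) cs → M ∈ extensions cs

solutions-complete cs {M} sat with all? viable? cs
... | yes _      = extensions-complete cs sat
... | no ¬viable = contradiction (all-viable M sat) ¬viable

extensions-complete {zero}  cs {[]}          sat = here refl
extensions-complete {suc n} cs {outside ∷ M} sat =
  ∈-++⁺ˡ {ys = extend inside cs}
    (∈-map⁺ (outside ∷_) (solutions-complete _ (consume-all outside M sat)))
extensions-complete {suc n} cs {inside ∷ M}  sat =
  ∈-++⁺ʳ _
    (∈-map⁺ (inside ∷_) (solutions-complete _ (consume-all inside M sat)))

solutions-sound : ∀ (cs : List (Clause n)) {M} → M ∈ solutions cs → All (Satisfies M) cs
extensions-sound : ∀ (cs : List (Clause n)) {M} →
  All Viable cs → M ∈ extensions cs → All (Satisfies M) cs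
extend-sound : ∀ b (cs : List (Clause (suc n))) {M} → M ∈ extend b cs → All (Satisfies M) cs

solutions-sound cs M∈ with all? viable? cs
... | yes viable = extensions-sound cs viable M∈
solutions-sound cs () | no _

extensions-sound {zero}  cs {[]} viable _ = All.map (λ {cl} → viable⇒satisfies[] cl) viable
extensions-sound {suc n} cs _ M∈ with ∈-++⁻ (extend outside cs) M∈
... | inj₁ M∈ˡ = extend-sound outside cs M∈ˡ
... | inj₂ M∈ʳ = extend-sound inside cs M∈ʳ

extend-sound b cs M∈ with ∈-map⁻ (b ∷_) M∈
... | M , M∈′ , refl = unconsume-all b M (solutions-sound _ M∈′)

perfectMatchings : (G : Graph) → List (EdgeSet G)
perfectMatchings G = solutions (map (λ v → 0 , incident G v) (allFin (nV G)))

perfectMatchings-sound : ∀ {G M} → M ∈ perfectMatchings G → IsPerfectMatching G M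
perfectMatchings-sound M∈ v = All.lookup (map⁻ (solutions-sound _ M∈)) (∈-allFin v)

perfectMatchings-complete : ∀ {G M} → IsPerfectMatching G M → M ∈ perfectMatchings G
perfectMatchings-complete pm = solutions-complete _ (map⁺ (tabulate⁺ pm))

Isolates : List (Subset n) → Subset n → Set
Isolates F S = ∃[ M ] (M ∈ F × M ⊆ ∁ S × ∀ {M′} → M′ ∈ F → M′ ⊆ ∁ S → M′ ≡ M)

antiForcing⇔isolates : ∀ {G S} → IsAntiForcingSet G S ⇔ Isolates (perfectMatchings G) S
antiForcing⇔isolates = mk⇔
  (λ (M , (M⊆∁S , pm) , unique) →
    M , perfectMatchings-complete pm , M⊆∁S ,
    λ M′∈ M′⊆∁S → unique _ (M′⊆∁S , perfectMatchings-sound M′∈))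
  (λ (M , M∈ , M⊆∁S , unique) →
    M , (M⊆∁S , perfectMatchings-sound M∈) ,
    λ M′ (M′⊆∁S , pm′) → unique (perfectMatchings-complete pm′) M′⊆∁S)

uniqueAvoider⇒isolates : ∀ (F : List (Subset n)) S →
  length (filter (_⊆? ∁ S) F) ≡ 1 → Isolates F S
uniqueAvoider⇒isolates F S one-avoider with filter (_⊆? ∁ S) F in avoiders≡[M]
... | M ∷ [] = M , M∈F , M⊆∁S , unique
  where
  M∈avoiders : M ∈ filter (_⊆? ∁ S) F
  M∈avoiders = subst (M ∈_) (sym avoiders≡[M]) (here refl)

  M∈F : M ∈ F
  M∈F = proj₁ (∈-filter⁻ (_⊆? ∁ S) {xs = F} M∈avoiders)

  M⊆∁S : M ⊆ ∁ S
  M⊆∁S = proj₂ (∈-filter⁻ (_⊆? ∁ S) {xs = F} M∈avoiders)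

  unique : ∀ {M′} → M′ ∈ F → M′ ⊆ ∁ S → M′ ≡ M
  unique M′∈ M′⊆∁S with subst (_ ∈_) avoiders≡[M] (∈-filter⁺ (_⊆? ∁ S) M′∈ M′⊆∁S)
  ... | here M′≡M = M′≡M

module _ {A : Set} (_≟ᴬ_ : DecidableEquality A) where

  -- An entry (a , s) is a member a of the family together with the suffix s
  -- of a still to be compared with S.
  Ambiguous : List (A × Subset m) → Subset m → Set
  Ambiguous L S = ∀ {a s} → (a , s) ∈ L → s ⊆ ∁ S →
    ∃[ a′ ] ∃[ s′ ] ((a′ , s′) ∈ L × s′ ⊆ ∁ S × a′ ≢ a)

  mixed : List (A × Subset m) → Bool
  mixed []            = true
  mixed ((a , _) ∷ L) = isYes (any? (λ e → ¬? (proj₁ e ≟ᴬ a)) L)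

  mixed⇒ambiguous : ∀ (L : List (A × Subset m)) {S} →
    T (mixed L) → (∀ {s} → s ⊆ ∁ S) → Ambiguous L S
  mixed⇒ambiguous ((a₀ , s₀) ∷ L) mixed-L ⊆∁S {a} _ _ with a ≟ᴬ a₀
  ... | no a≢a₀ = a₀ , s₀ , here refl , ⊆∁S , a≢a₀ ∘ sym
  ... | yes refl with find (toWitness mixed-L)
  ...   | (a₁ , s₁) , e∈L , a₁≢a₀ = a₁ , s₁ , there e∈L , ⊆∁S , a₁≢a₀

  tails : List (A × Subset (suc m)) → List (A × Subset m)
  tails = map (map₂ tail)

  startsOutside? : Decidable {A = A × Subset (suc m)} λ e → head (proj₂ e) ≡ outside
  startsOutside? e = head (proj₂ e) Bool.≟ outside

  outsideTails : List (A × Subset (suc m)) → List (A × Subset m)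
  outsideTails L = tails (filter startsOutside? L)

  ambiguousUpTo : ℕ → List (A × Subset m) → Bool
  ambiguousUpTo         _       []          = true
  ambiguousUpTo         zero    L@(_ ∷ _)   = mixed L
  ambiguousUpTo {zero}  (suc k) L@(_ ∷ _)   = mixed L
  ambiguousUpTo {suc m} (suc k) L@(_ ∷ _)   =
    ambiguousUpTo (suc k) (tails L) ∧ ambiguousUpTo k (outsideTails L)

  tails-ambiguous : ∀ (L : List (A × Subset (suc m))) {S} →
    Ambiguous (tails L) S → Ambiguous L (outside ∷ S)
  tails-ambiguous L ambiguous {s = b ∷ s} e∈L b∷s⊆∁S
    with ambiguous (∈-map⁺ (map₂ tail) e∈L) (drop-∷-⊆ b∷s⊆∁S)
  ... | a′ , s′ , e′∈ , s′⊆∁S , a′≢a with ∈-map⁻ (map₂ tail) e′∈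
  ...   | (_ , b′ ∷ _) , e″∈L , refl = a′ , b′ ∷ s′ , e″∈L , ∷⊆inside∷ b′ s′⊆∁S , a′≢a

  outsideTails-ambiguous : ∀ (L : List (A × Subset (suc m))) {S} →
    Ambiguous (outsideTails L) S → Ambiguous L (inside ∷ S)
  outsideTails-ambiguous L ambiguous {s = b ∷ s} e∈L b∷s⊆∁S with ∷⊆outside∷⇒outside b∷s⊆∁S
  ... | refl with ambiguous (∈-map⁺ (map₂ tail) (∈-filter⁺ startsOutside? {xs = L} e∈L refl))
                            (drop-∷-⊆ b∷s⊆∁S)
  ... | a′ , s′ , e′∈ , s′⊆∁S , a′≢a with ∈-map⁻ (map₂ tail) e′∈
  ...   | (_ , _ ∷ _) , e″∈ , refl with ∈-filter⁻ startsOutside? {xs = L} e″∈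
  ...     | e″∈L , refl = a′ , outside ∷ s′ , e″∈L , out⊆ s′⊆∁S , a′≢a

  ambiguousUpTo-sound : ∀ k (L : List (A × Subset m)) → T (ambiguousUpTo k L) →
    ∀ S → ∣ S ∣ ≤ k → Ambiguous L S
  ambiguousUpTo-sound _ [] _ _ _ ()
  ambiguousUpTo-sound zero L@(_ ∷ _) ok S ∣S∣≤0 = mixed⇒ambiguous L ok (∣p∣≤0⇒q⊆∁p ∣S∣≤0)
  ambiguousUpTo-sound {zero} (suc k) L@(_ ∷ _) ok [] _ = mixed⇒ambiguous L ok (∣p∣≤0⇒q⊆∁p z≤n)
  ambiguousUpTo-sound {suc m} (suc k) L@(_ ∷ _) ok (outside ∷ S) ∣S∣≤1+k =
    tails-ambiguous L
      (ambiguousUpTo-sound (suc k) (tails L) (proj₁ (Equivalence.to T-∧ ok)) S ∣S∣≤1+k)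
  ambiguousUpTo-sound {suc m} (suc k) L@(_ ∷ _) ok (inside ∷ S) (s≤s ∣S∣≤k) =
    outsideTails-ambiguous L
      (ambiguousUpTo-sound k (outsideTails L) (proj₂ (Equivalence.to T-∧ ok)) S ∣S∣≤k)

labelled : List (Subset n) → List (Subset n × Subset n)
labelled = map λ M → M , M

isolates⇒<∣∣ : ∀ k (F : List (Subset n)) →
  ambiguousUpTo (≡-dec Bool._≟_) k (labelled F) ≡ true →
  ∀ {S} → Isolates F S → k < ∣ S ∣
isolates⇒<∣∣ k F ok {S} (M , M∈F , M⊆∁S , unique) with ≤-<-connex ∣ S ∣ k
... | inj₂ k<∣S∣ = k<∣S∣
... | inj₁ ∣S∣≤k
  with ambiguousUpTo-sound (≡-dec Bool._≟_) k (labelled F) (Equivalence.from T-≡ ok) S ∣S∣≤k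
         (∈-map⁺ _ M∈F) M⊆∁S
... | _ , _ , e∈ , M′⊆∁S , M′≢M with ∈-map⁻ _ e∈
...   | M′ , M′∈F , refl = contradiction (unique M′∈F M′⊆∁S) M′≢M

-- The edges 0–1, 0–2, 1–5, 2–3 and 3–11.
S₀ : EdgeSet F26
S₀ = ⋃ (⁅ # 0 ⁆ ∷ ⁅ # 1 ⁆ ∷ ⁅ # 3 ⁆ ∷ ⁅ # 5 ⁆ ∷ ⁅ # 8 ⁆ ∷ [])

S₀-isolates : Isolates (perfectMatchings F26) S₀
S₀-isolates = uniqueAvoider⇒isolates (perfectMatchings F26) S₀ refl

perfectMatchings-ambiguousUpTo-4 : ambiguousUpTo (≡-dec Bool._≟_) 4 (labelled (perfectMatchings F26)) ≡ true
perfectMatchings-ambiguousUpTo-4 = refl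

fourEdgesNeverIsolate : ∀ {S} → Isolates (perfectMatchings F26) S → 4 < ∣ S ∣
fourEdgesNeverIsolate = isolates⇒<∣∣ 4 (perfectMatchings F26) perfectMatchings-ambiguousUpTo-4

mainTheorem3 : AntiForcingNumber F26 5
mainTheorem3 =
  (S₀ , Equivalence.from (antiForcing⇔isolates {F26} {S₀}) S₀-isolates , refl) ,
  λ S antiForcing →
    fourEdgesNeverIsolate (Equivalence.to (antiForcing⇔isolates {F26} {S}) antiForcing)
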